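{- Let $a,b\in\mathbb N^q$ and $c\in\mathbb N^s$ be row vectors, $B=\sum_ib_i$, $C=\sum_ic_i$, and $n\ge2$. Then $$\Gamma_n\begin{pmatrix}a&c\\ b&0\end{pmatrix}=\frac{(n-2)!!\,(B+C+n-2)!!}{(B+n-2)!!\,(C+n-2)!!}\,\Gamma_{n+C}\begin{pmatrix}a\\ b\end{pmatrix}.$$
   Context: For an integer $m\ge0$, $m!!$ denotes $(m-1)(m-3)\cdots$, the product of positive integers $\le m-1$ with the parity of $m-1$ (empty product $=1$). For a two-row matrix $(x_{it})\in M_{2\times q}(\mathbb N)$ and $0\le r\le q$, let $P_r$ be the multiset of numbers $\sum_{t\in S}x_{i_tt}$, where $S$ ranges over the $r$-element subsets of $\{1,\dots,q\}$ and $(i_t)_{t\in S}$ over all maps $S\to\{1,2\}$ (so $P_0=\{0\}$). Writing $\langle M\rangle_n=\prod_{m\in M}(m+n-2)!!$ for a multiset $M$ and $A,B$ for the two row sums, $$\Gamma_n=\frac{(n-2)!!\prod_{0\le r\le q,\ q-r\text{ even}}\langle P_r\rangle_n}{(A+n-2)!!\,(B+n-2)!!\prod_{0\le r\le q,\ q-r\text{ odd}}\langle P_r\rangle_n}.$$ -}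

module Defs where

open import Data.Nat using (ℕ; zero; suc; _+_; _*_; _∸_; NonZero; _%_)
open import Data.Nat.Properties using (m*n≢0)
open import Data.Bool using (Bool; true; false; if_then_else_)
open import Data.List using (List; []; _∷_; _++_; map; upTo)
open import Data.Vec using (Vec; []; _∷_) renaming (sum to vsum)
open import Data.Integer using (+_)
open import Data.Rational using (ℚ; _/_)

-- Double factorial in the paper's convention:
-- m !! = (m-1)(m-3)... = product of positive integers ≤ m-1 with the parity of m-1.
dfact : ℕ → ℕ
dfact zero = 1
dfact (suc zero) = 1
dfact (suc (suc k)) = suc k * dfact k

dfact-nz : ∀ m → NonZero (dfact m)
dfact-nz zero = _
dfact-nz (suc zero) = _
dfact-nz (suc (suc k)) = m*n≢0 (suc k) (dfact k) {{_}} {{dfact-nz k}}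

-- The multiset P_r (as a list) for the two-row matrix with rows x, y:
-- all sums Σ_{t∈S} x_{i_t t} over r-subsets S of the columns and maps S → {1,2}.
P : ∀ {q} → ℕ → Vec ℕ q → Vec ℕ q → List ℕ
P zero _ _ = 0 ∷ []
P (suc r) [] [] = []
P (suc r) (x ∷ xs) (y ∷ ys) =
  P (suc r) xs ys ++ (map (λ m → x + m) (P r xs ys) ++ map (λ m → y + m) (P r xs ys))

bracket : List ℕ → ℕ → ℕ
bracket [] n = 1
bracket (m ∷ M) n = dfact (m + n ∸ 2) * bracket M n

bracket-nz : ∀ M n → NonZero (bracket M n)
bracket-nz [] n = _
bracket-nz (m ∷ M) n =
  m*n≢0 (dfact (m + n ∸ 2)) (bracket M n) {{dfact-nz (m + n ∸ 2)}} {{bracket-nz M n}}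

prodL : List ℕ → (ℕ → ℕ) → ℕ
prodL [] f = 1
prodL (r ∷ rs) f = f r * prodL rs f

isEven : ℕ → Bool
isEven zero = true
isEven (suc zero) = false
isEven (suc (suc k)) = isEven k

evenProd : ∀ {q} → ℕ → Vec ℕ q → Vec ℕ q → ℕ
evenProd {q} n x y =
  prodL (upTo (suc q)) (λ r → if isEven (q ∸ r) then bracket (P r x y) n else 1)

oddProd : ∀ {q} → ℕ → Vec ℕ q → Vec ℕ q → ℕ
oddProd {q} n x y =
  prodL (upTo (suc q)) (λ r → if isEven (q ∸ r) then 1 else bracket (P r x y) n)

prodL-nz : ∀ rs (f : ℕ → ℕ) → (∀ r → NonZero (f r)) → NonZero (prodL rs f)
prodL-nz [] f h = _
prodL-nz (r ∷ rs) f h = m*n≢0 (f r) (prodL rs f) {{h r}} {{prodL-nz rs f h}}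

oddProd-nz : ∀ {q} n (x y : Vec ℕ q) → NonZero (oddProd n x y)
oddProd-nz {q} n x y = prodL-nz (upTo (suc q)) _ h
  where
  h : ∀ r → NonZero (if isEven (q ∸ r) then 1 else bracket (P r x y) n)
  h r with isEven (q ∸ r)
  ... | true = _
  ... | false = bracket-nz (P r x y) n

ΓNum : ∀ {q} → ℕ → Vec ℕ q → Vec ℕ q → ℕ
ΓNum n x y = dfact (n ∸ 2) * evenProd n x y

ΓDen : ∀ {q} → ℕ → Vec ℕ q → Vec ℕ q → ℕ
ΓDen n x y = (dfact (vsum x + n ∸ 2) * dfact (vsum y + n ∸ 2)) * oddProd n x y

ΓDen-nz : ∀ {q} n (x y : Vec ℕ q) → NonZero (ΓDen n x y)
ΓDen-nz n x y =
  m*n≢0 (dfact (vsum x + n ∸ 2) * dfact (vsum y + n ∸ 2)) (oddProd n x y)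
    {{m*n≢0 (dfact (vsum x + n ∸ 2)) (dfact (vsum y + n ∸ 2))
      {{dfact-nz (vsum x + n ∸ 2)}} {{dfact-nz (vsum y + n ∸ 2)}}}}
    {{oddProd-nz n x y}}

Γ : ∀ {q} → ℕ → Vec ℕ q → Vec ℕ q → ℚ
Γ n x y = _/_ (+ ΓNum n x y) (ΓDen n x y) {{ΓDen-nz n x y}}

dfRatio : ℕ → ℕ → ℕ → ℕ → ℚ
dfRatio a b c d =
  _/_ (+ (dfact a * dfact b)) (dfact c * dfact d) {{m*n≢0 (dfact c) (dfact d) {{dfact-nz c}} {{dfact-nz d}}}}

-- Write E_n and O_n for the products of ⟨P_r⟩_n over the r with q − r even, resp. odd, so that
-- Γ_n = (n−2)!! E_n / ((A+n−2)!! (B+n−2)!! O_n).  Sorting the summands of P_{r+1} by whether they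
-- use the first column (x, y) shows that the ratio G_n = E_n / O_n obeys
--   G_n(x∷xs, y∷ys) = G_{x+n}(xs, ys) G_{y+n}(xs, ys) / G_n(xs, ys),   G_n(∅) = (n−2)!!.
-- For a zero second row this gives G_n(c, 0) = (C+n−2)!! by induction on c; hence the columns (c, 0)
-- behave like the empty matrix at n + C, and induction on a gives G_n(a++c, b++0) = G_{n+C}(a, b).
-- The theorem is this identity with the outer double factorials collected.
module Submission where

open import Defs
open import Data.Nat using (ℕ; _+_; _∸_; _≤_)
open import Data.Vec using (Vec; _++_; replicate; sum)
open import Relation.Binary.PropositionalEquality using (_≡_)

open import Data.Bool using (Bool; true; false; not; _xor_; if_then_else_)
open import Data.Bool.Properties using (not-distribˡ-xor; not-distribʳ-xor; if-not; if-eta)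
open import Data.List using ([]; _∷_; map; applyUpTo) renaming (_++_ to _++ₗ_)
import Data.Nat as ℕ
open import Data.Nat using (zero; suc; _<_; s≤s; z≤n; NonZero)
open import Data.Nat.Properties using (m*n≢0)
open import Data.Vec using ([]; _∷_)
open import Data.Vec.Properties using (sum-++)
open import Function using (_∘_; id)
open import Relation.Binary.PropositionalEquality using (refl; sym; trans; cong; cong₂; subst; module ≡-Reasoning)

-- Arithmetic on ℕ, in its own module so that _*_ at the top level is the product on ℚ.
module _ where
  open import Data.Nat using (_*_)
  open import Data.Nat.Properties
    using ( *-identityˡ; *-identityʳ; *-assoc; +-assoc; +-comm; +-identityʳ
          ; m<n⇒m<1+n; n<1+n; +-∸-assoc; [m*n]*[o*p]≡[m*o]*[n*p])
  open import Data.Nat.Tactic.RingSolver using (solve-∀)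
  open ≡-Reasoning

  ∏< : ℕ → (ℕ → ℕ) → ℕ
  ∏< zero    g = 1
  ∏< (suc k) g = g 0 * ∏< k (g ∘ suc)

  prodL-applyUpTo : ∀ k f g → prodL (applyUpTo f k) g ≡ ∏< k (g ∘ f)
  prodL-applyUpTo zero    f g = refl
  prodL-applyUpTo (suc k) f g = cong (g (f 0) *_) (prodL-applyUpTo k (f ∘ suc) g)

  ∏<-suc-last : ∀ k g → ∏< (suc k) g ≡ ∏< k g * g k
  ∏<-suc-last zero    g = trans (*-identityʳ (g 0)) (sym (*-identityˡ (g 0)))
  ∏<-suc-last (suc k) g = trans (cong (g 0 *_) (∏<-suc-last k (g ∘ suc))) (sym (*-assoc (g 0) _ _))

  ∏<-distrib-* : ∀ k f g → ∏< k (λ r → f r * g r) ≡ ∏< k f * ∏< k g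
  ∏<-distrib-* zero    f g = refl
  ∏<-distrib-* (suc k) f g = trans (cong (f 0 * g 0 *_) (∏<-distrib-* k (f ∘ suc) (g ∘ suc)))
                                   ([m*n]*[o*p]≡[m*o]*[n*p] (f 0) (g 0) _ _)

  ∏<-cong : ∀ k {f g} → (∀ {r} → r < k → f r ≡ g r) → ∏< k f ≡ ∏< k g
  ∏<-cong zero    f≡g = refl
  ∏<-cong (suc k) f≡g = cong₂ _*_ (f≡g (s≤s z≤n)) (∏<-cong k (λ r<k → f≡g (s≤s r<k)))

  bracket-++ : ∀ L M n → bracket (L ++ₗ M) n ≡ bracket L n * bracket M n
  bracket-++ []      M n = sym (*-identityˡ (bracket M n))
  bracket-++ (m ∷ L) M n =
    trans (cong (dfact (m + n ∸ 2) *_) (bracket-++ L M n)) (sym (*-assoc (dfact (m + n ∸ 2)) _ _))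

  bracket-shift : ∀ k L n → bracket (map (k +_) L) n ≡ bracket L (k + n)
  bracket-shift k []      n = refl
  bracket-shift k (m ∷ L) n =
    cong₂ _*_ (cong (λ z → dfact (z ∸ 2)) (shift-+ k m n)) (bracket-shift k L n)
    where
    shift-+ : ∀ k m n → k + m + n ≡ m + (k + n)
    shift-+ = solve-∀

  bracket-P-∷ : ∀ {q} r x y (xs ys : Vec ℕ q) n →
    bracket (P (suc r) (x ∷ xs) (y ∷ ys)) n
      ≡ bracket (P (suc r) xs ys) n * (bracket (P r xs ys) (x + n) * bracket (P r xs ys) (y + n))
  bracket-P-∷ r x y xs ys n = begin
    bracket (P (suc r) xs ys ++ₗ (map (x +_) (P r xs ys) ++ₗ map (y +_) (P r xs ys))) n
      ≡⟨ bracket-++ (P (suc r) xs ys) _ n ⟩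
    bracket (P (suc r) xs ys) n * bracket (map (x +_) (P r xs ys) ++ₗ map (y +_) (P r xs ys)) n
      ≡⟨ cong (bracket (P (suc r) xs ys) n *_) (bracket-++ (map (x +_) (P r xs ys)) _ n) ⟩
    bracket (P (suc r) xs ys) n * (bracket (map (x +_) (P r xs ys)) n * bracket (map (y +_) (P r xs ys)) n)
      ≡⟨ cong (bracket (P (suc r) xs ys) n *_)
              (cong₂ _*_ (bracket-shift x (P r xs ys) n) (bracket-shift y (P r xs ys) n)) ⟩
    bracket (P (suc r) xs ys) n * (bracket (P r xs ys) (x + n) * bracket (P r xs ys) (y + n)) ∎

  P-empty : ∀ {q r} (xs ys : Vec ℕ q) → q < r → P r xs ys ≡ []
  P-empty {r = suc r} []       []       _             = refl
  P-empty {r = suc r} (x ∷ xs) (y ∷ ys) (s≤s q<r)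
    rewrite P-empty xs ys (m<n⇒m<1+n q<r) | P-empty xs ys q<r = refl

  isEven-suc : ∀ m → isEven (suc m) ≡ not (isEven m)
  isEven-suc zero          = refl
  isEven-suc (suc zero)    = refl
  isEven-suc (suc (suc m)) = isEven-suc m

  xor-isEven-suc : ∀ odd m → odd xor isEven (suc m) ≡ not odd xor isEven m
  xor-isEven-suc odd m = begin
    odd xor isEven (suc m)  ≡⟨ cong (odd xor_) (isEven-suc m) ⟩
    odd xor not (isEven m)  ≡⟨ not-distribʳ-xor odd (isEven m) ⟨
    not (odd xor isEven m)  ≡⟨ not-distribˡ-xor odd (isEven m) ⟩
    not odd xor isEven m    ∎

  if-*-else-1 : ∀ b x y → (if b then x * y else 1) ≡ (if b then x else 1) * (if b then y else 1)
  if-*-else-1 true  x y = refl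
  if-*-else-1 false x y = refl

  parityProd : ∀ {q} → Bool → ℕ → Vec ℕ q → Vec ℕ q → ℕ
  parityProd {q} odd n x y =
    ∏< (suc q) (λ r → if odd xor isEven (q ∸ r) then bracket (P r x y) n else 1)

  evenProd≡parityProd : ∀ {q} n (x y : Vec ℕ q) → evenProd n x y ≡ parityProd false n x y
  evenProd≡parityProd {q} n x y =
    prodL-applyUpTo (suc q) id (λ r → if isEven (q ∸ r) then bracket (P r x y) n else 1)

  oddProd≡parityProd : ∀ {q} n (x y : Vec ℕ q) → oddProd n x y ≡ parityProd true n x y
  oddProd≡parityProd {q} n x y =
    trans (prodL-applyUpTo (suc q) id (λ r → if isEven (q ∸ r) then 1 else bracket (P r x y) n))
          (∏<-cong (suc q) (λ {r} _ → sym (if-not (isEven (q ∸ r)) {bracket (P r x y) n} {1})))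

  parityProd-∷ : ∀ {q} odd n x y (xs ys : Vec ℕ q) →
    parityProd odd n (x ∷ xs) (y ∷ ys)
      ≡ parityProd (not odd) n xs ys * (parityProd odd (x + n) xs ys * parityProd odd (y + n) xs ys)
  parityProd-∷ {q} odd n x y xs ys = begin
      first * ∏< (suc q) (λ r → keep r (bracket (P (suc r) (x ∷ xs) (y ∷ ys)) n))
    ≡⟨ cong (first *_) (∏<-cong (suc q) (λ {r} _ → split r)) ⟩
      first * ∏< (suc q) (λ r → T r * (U r * V r))
    ≡⟨ cong (first *_) (trans (∏<-distrib-* (suc q) T (λ r → U r * V r))
                              (cong (∏< (suc q) T *_) (∏<-distrib-* (suc q) U V))) ⟩
      first * (∏< (suc q) T * (Πˣ * Πʸ))
    ≡⟨ *-assoc first (∏< (suc q) T) (Πˣ * Πʸ) ⟨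
      (first * ∏< (suc q) T) * (Πˣ * Πʸ)
    ≡⟨ cong (_* (Πˣ * Πʸ)) reassemble ⟩
      parityProd (not odd) n xs ys * (Πˣ * Πʸ) ∎
    where
    Πˣ Πʸ : ℕ
    Πˣ = parityProd odd (x + n) xs ys
    Πʸ = parityProd odd (y + n) xs ys

    keep : ℕ → ℕ → ℕ
    keep r m = if odd xor isEven (q ∸ r) then m else 1

    first : ℕ
    first = if odd xor isEven (suc q) then bracket (P 0 xs ys) n else 1

    T U V : ℕ → ℕ
    T r = keep r (bracket (P (suc r) xs ys) n)
    U r = keep r (bracket (P r xs ys) (x + n))
    V r = keep r (bracket (P r xs ys) (y + n))

    split : ∀ r → keep r (bracket (P (suc r) (x ∷ xs) (y ∷ ys)) n) ≡ T r * (U r * V r)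
    split r = trans (cong (keep r) (bracket-P-∷ r x y xs ys n))
                    (trans (if-*-else-1 b P⁺ (Pˣ * Pʸ)) (cong (T r *_) (if-*-else-1 b Pˣ Pʸ)))
      where
      b : Bool
      b = odd xor isEven (q ∸ r)
      P⁺ Pˣ Pʸ : ℕ
      P⁺ = bracket (P (suc r) xs ys) n
      Pˣ = bracket (P r xs ys) (x + n)
      Pʸ = bracket (P r xs ys) (y + n)

    -- T r is the factor of P_{r+1}(xs, ys), which parityProd (not odd) indexes by r + 1:
    -- the parity of the co-rank flips, and the last factor P_{q+1}(xs, ys) = ∅ drops out.
    last≡1 : T q ≡ 1
    last≡1 = trans (cong (λ L → keep q (bracket L n)) (P-empty xs ys (n<1+n q)))
                   (if-eta (odd xor isEven (q ∸ q)))

    flip : ∀ {r} → r < q → T r ≡ (if not odd xor isEven (q ∸ suc r) then bracket (P (suc r) xs ys) n else 1)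
    flip {r} r<q = cong (λ b → if b then bracket (P (suc r) xs ys) n else 1)
                        (trans (cong (λ m → odd xor isEven m) (+-∸-assoc 1 r<q)) (xor-isEven-suc odd (q ∸ suc r)))

    reassemble : first * ∏< (suc q) T ≡ parityProd (not odd) n xs ys
    reassemble = begin
        first * ∏< (suc q) T
      ≡⟨ cong (first *_) (trans (∏<-suc-last q T) (trans (cong (∏< q T *_) last≡1) (*-identityʳ (∏< q T)))) ⟩
        first * ∏< q T
      ≡⟨ cong₂ _*_ (cong (λ b → if b then bracket (P 0 xs ys) n else 1) (xor-isEven-suc odd q)) (∏<-cong q flip) ⟩
        parityProd (not odd) n xs ys ∎

  parityProd-even-[] : ∀ n → parityProd false n [] [] ≡ dfact (n ∸ 2)
  parityProd-even-[] n = trans (*-identityʳ (dfact (n ∸ 2) * 1)) (*-identityʳ (dfact (n ∸ 2)))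

  parityProd-zeros : ∀ {s} (c : Vec ℕ s) n →
    parityProd false n c (replicate s 0) ≡ dfact (sum c + n ∸ 2) * parityProd true n c (replicate s 0)
  parityProd-zeros []               n = *-identityʳ (dfact (n ∸ 2) * 1)
  parityProd-zeros {suc s} (γ ∷ c) n = begin
      parityProd false n (γ ∷ c) (0 ∷ Z)
    ≡⟨ parityProd-∷ false n γ 0 c Z ⟩
      O n * (E (γ + n) * E n)
    ≡⟨ cong₂ (λ u v → O n * (u * v)) (parityProd-zeros c (γ + n)) (parityProd-zeros c n) ⟩
      O n * ((dfact (sum c + (γ + n) ∸ 2) * O (γ + n)) * (dfact (sum c + n ∸ 2) * O n))
    ≡⟨ cong (λ m → O n * ((dfact (m ∸ 2) * O (γ + n)) * (dfact (sum c + n ∸ 2) * O n))) (sum-shift (sum c) γ n) ⟩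
      O n * ((dfact (γ + sum c + n ∸ 2) * O (γ + n)) * (dfact (sum c + n ∸ 2) * O n))
    ≡⟨ regroup (O n) (dfact (γ + sum c + n ∸ 2)) (O (γ + n)) (dfact (sum c + n ∸ 2)) ⟩
      dfact (γ + sum c + n ∸ 2) * ((dfact (sum c + n ∸ 2) * O n) * (O (γ + n) * O n))
    ≡⟨ cong (λ e → dfact (γ + sum c + n ∸ 2) * (e * (O (γ + n) * O n))) (parityProd-zeros c n) ⟨
      dfact (γ + sum c + n ∸ 2) * (E n * (O (γ + n) * O n))
    ≡⟨ cong (dfact (γ + sum c + n ∸ 2) *_) (parityProd-∷ true n γ 0 c Z) ⟨
      dfact (sum (γ ∷ c) + n ∸ 2) * parityProd true n (γ ∷ c) (0 ∷ Z) ∎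
    where
    Z : Vec ℕ s
    Z = replicate s 0
    E O : ℕ → ℕ
    E m = parityProd false m c Z
    O m = parityProd true m c Z
    sum-shift : ∀ σ γ n → σ + (γ + n) ≡ γ + σ + n
    sum-shift = solve-∀
    regroup : ∀ o d₁ o₁ d₀ → o * ((d₁ * o₁) * (d₀ * o)) ≡ d₁ * ((d₀ * o) * (o₁ * o))
    regroup = solve-∀

  -- eᵢ / oᵢ = fᵢ / pᵢ for i = 0, 1, 2 implies o₀e₁e₂ / (e₀o₁o₂) = p₀f₁f₂ / (f₀p₁p₂), cross-multiplied.
  cross-step : ∀ e₀ o₀ f₀ p₀ e₁ o₁ f₁ p₁ e₂ o₂ f₂ p₂ →
    e₀ * p₀ ≡ f₀ * o₀ → e₁ * p₁ ≡ f₁ * o₁ → e₂ * p₂ ≡ f₂ * o₂ →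
    (o₀ * (e₁ * e₂)) * (f₀ * (p₁ * p₂)) ≡ (p₀ * (f₁ * f₂)) * (e₀ * (o₁ * o₂))
  cross-step e₀ o₀ f₀ p₀ e₁ o₁ f₁ p₁ e₂ o₂ f₂ p₂ h₀ h₁ h₂ = begin
      (o₀ * (e₁ * e₂)) * (f₀ * (p₁ * p₂))   ≡⟨ regroup o₀ e₁ e₂ f₀ p₁ p₂ ⟩
      (e₁ * p₁) * ((e₂ * p₂) * (f₀ * o₀))   ≡⟨ cong₂ _*_ h₁ (cong₂ _*_ h₂ (sym h₀)) ⟩
      (f₁ * o₁) * ((f₂ * o₂) * (e₀ * p₀))   ≡⟨ regroup p₀ f₁ f₂ e₀ o₁ o₂ ⟨
      (p₀ * (f₁ * f₂)) * (e₀ * (o₁ * o₂))   ∎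
    where
    regroup : ∀ o e e' f p p' → (o * (e * e')) * (f * (p * p')) ≡ (e * p) * ((e' * p') * (f * o))
    regroup = solve-∀

  parityProd-++-zeros : ∀ {q s} (a b : Vec ℕ q) (c : Vec ℕ s) n →
    parityProd false n (a ++ c) (b ++ replicate s 0) * parityProd true (n + sum c) a b
      ≡ parityProd false (n + sum c) a b * parityProd true n (a ++ c) (b ++ replicate s 0)
  parityProd-++-zeros {s = s} [] [] c n = begin
      Eᶜ * 1
    ≡⟨ *-identityʳ Eᶜ ⟩
      Eᶜ
    ≡⟨ parityProd-zeros c n ⟩
      dfact (sum c + n ∸ 2) * Oᶜ
    ≡⟨ cong (λ m → dfact (m ∸ 2) * Oᶜ) (+-comm (sum c) n) ⟩
      dfact (n + sum c ∸ 2) * Oᶜ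
    ≡⟨ cong (_* Oᶜ) (parityProd-even-[] (n + sum c)) ⟨
      parityProd false (n + sum c) [] [] * Oᶜ ∎
    where
    Eᶜ Oᶜ : ℕ
    Eᶜ = parityProd false n c (replicate s 0)
    Oᶜ = parityProd true n c (replicate s 0)
  parityProd-++-zeros {suc q} {s} (a₀ ∷ a) (b₀ ∷ b) c n = begin
      parityProd false n (a₀ ∷ X) (b₀ ∷ Y) * parityProd true (n + S) (a₀ ∷ a) (b₀ ∷ b)
    ≡⟨ cong₂ _*_ (parityProd-∷ false n a₀ b₀ X Y) (parityProd-∷ true (n + S) a₀ b₀ a b) ⟩
      (Oˣ n * (Eˣ (a₀ + n) * Eˣ (b₀ + n))) * (Eᵃ (n + S) * (Oᵃ (a₀ + (n + S)) * Oᵃ (b₀ + (n + S))))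
    ≡⟨ cross-step (Eˣ n) (Oˣ n) (Eᵃ (n + S)) (Oᵃ (n + S))
                  (Eˣ (a₀ + n)) (Oˣ (a₀ + n)) (Eᵃ (a₀ + (n + S))) (Oᵃ (a₀ + (n + S)))
                  (Eˣ (b₀ + n)) (Oˣ (b₀ + n)) (Eᵃ (b₀ + (n + S))) (Oᵃ (b₀ + (n + S)))
                  (parityProd-++-zeros a b c n) (shifted a₀) (shifted b₀) ⟩
      (Oᵃ (n + S) * (Eᵃ (a₀ + (n + S)) * Eᵃ (b₀ + (n + S)))) * (Eˣ n * (Oˣ (a₀ + n) * Oˣ (b₀ + n)))
    ≡⟨ cong₂ _*_ (parityProd-∷ false (n + S) a₀ b₀ a b) (parityProd-∷ true n a₀ b₀ X Y) ⟨
      parityProd false (n + S) (a₀ ∷ a) (b₀ ∷ b) * parityProd true n (a₀ ∷ X) (b₀ ∷ Y) ∎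
    where
    S : ℕ
    S = sum c
    X Y : Vec ℕ (q + s)
    X = a ++ c
    Y = b ++ replicate s 0
    Eˣ Oˣ Eᵃ Oᵃ : ℕ → ℕ
    Eˣ m = parityProd false m X Y
    Oˣ m = parityProd true m X Y
    Eᵃ m = parityProd false m a b
    Oᵃ m = parityProd true m a b
    shifted : ∀ k → Eˣ (k + n) * Oᵃ (k + (n + S)) ≡ Eᵃ (k + (n + S)) * Oˣ (k + n)
    shifted k = subst (λ m → Eˣ (k + n) * Oᵃ m ≡ Eᵃ m * Oˣ (k + n))
                      (+-assoc k n S) (parityProd-++-zeros a b c (k + n))

  sum-replicate-0 : ∀ s → sum (replicate s 0) ≡ 0
  sum-replicate-0 zero    = refl
  sum-replicate-0 (suc s) = sum-replicate-0 s

  Γ-cross : ∀ {q s} (a b : Vec ℕ q) (c : Vec ℕ s) n →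
    ΓNum n (a ++ c) (b ++ replicate s 0) * ((dfact (sum b + n ∸ 2) * dfact (sum c + n ∸ 2)) * ΓDen (n + sum c) a b)
      ≡ ((dfact (n ∸ 2) * dfact (sum b + sum c + n ∸ 2)) * ΓNum (n + sum c) a b) * ΓDen n (a ++ c) (b ++ replicate s 0)
  Γ-cross {s = s} a b c n
    rewrite evenProd≡parityProd n (a ++ c) (b ++ replicate s 0) | oddProd≡parityProd n (a ++ c) (b ++ replicate s 0)
          | evenProd≡parityProd (n + sum c) a b | oddProd≡parityProd (n + sum c) a b
          | sum-++ {ys = c} a | sum-++ {ys = replicate s 0} b | sum-replicate-0 s | +-identityʳ (sum b)
          | +-assoc (sum a) (sum c) n | +-assoc (sum b) (sum c) n | +-comm (sum c) n
    = regroup (dfact (n ∸ 2)) (dfact (sum b + n ∸ 2)) (dfact (n + sum c ∸ 2))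
              (dfact (sum a + (n + sum c) ∸ 2)) (dfact (sum b + (n + sum c) ∸ 2))
              (parityProd-++-zeros a b c n)
    where
    regroup : ∀ d₀ d_b d_c d_a d_bc {e o e' o'} → e * o ≡ e' * o' →
      (d₀ * e) * ((d_b * d_c) * ((d_a * d_bc) * o)) ≡ ((d₀ * d_bc) * (d_c * e')) * ((d_a * d_b) * o')
    regroup d₀ d_b d_c d_a d_bc {e} {o} {e'} {o'} eo≡e'o' = begin
      (d₀ * e) * ((d_b * d_c) * ((d_a * d_bc) * o))      ≡⟨ move d₀ d_b d_c d_a d_bc e o ⟩
      (e * o) * (d₀ * d_b * d_c * d_a * d_bc)             ≡⟨ cong (_* (d₀ * d_b * d_c * d_a * d_bc)) eo≡e'o' ⟩
      (e' * o') * (d₀ * d_b * d_c * d_a * d_bc)           ≡⟨ move′ d₀ d_b d_c d_a d_bc e' o' ⟩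
      ((d₀ * d_bc) * (d_c * e')) * ((d_a * d_b) * o')     ∎
      where
      move : ∀ d₀ d_b d_c d_a d_bc e o →
        (d₀ * e) * ((d_b * d_c) * ((d_a * d_bc) * o)) ≡ (e * o) * (d₀ * d_b * d_c * d_a * d_bc)
      move = solve-∀
      move′ : ∀ d₀ d_b d_c d_a d_bc e o →
        (e * o) * (d₀ * d_b * d_c * d_a * d_bc) ≡ ((d₀ * d_bc) * (d_c * e)) * ((d_a * d_b) * o)
      move′ = solve-∀

open import Data.Integer using (+_)
import Data.Integer as ℤ
open import Data.Integer.Properties using (pos-*)
open import Data.Rational using (ℚ; _*_; _/_; toℚᵘ)
open import Data.Rational.Properties using (toℚᵘ-injective; toℚᵘ-homo-*; toℚᵘ-fromℚᵘ)
open import Data.Rational.Unnormalised using (mkℚᵘ; *≡*)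
import Data.Rational.Unnormalised as ℚᵘ
import Data.Rational.Unnormalised.Properties as ℚᵘ

cross⇒/≡/*/ : ∀ p d q e r f .{{_ : NonZero d}} .{{_ : NonZero e}} .{{_ : NonZero f}} →
  p ℕ.* (e ℕ.* f) ≡ (q ℕ.* r) ℕ.* d → + p / d ≡ (+ q / e) * (+ r / f)
cross⇒/≡/*/ p (suc d) q (suc e) r (suc f) cross = toℚᵘ-injective (begin
    toℚᵘ (+ p / suc d)                         ≈⟨ toℚᵘ-fromℚᵘ (mkℚᵘ (+ p) d) ⟩
    mkℚᵘ (+ p) d                               ≈⟨ *≡* cross-ℤ ⟩
    mkℚᵘ (+ q) e ℚᵘ.* mkℚᵘ (+ r) f             ≈⟨ ℚᵘ.*-cong (toℚᵘ-fromℚᵘ (mkℚᵘ (+ q) e))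
                                                             (toℚᵘ-fromℚᵘ (mkℚᵘ (+ r) f)) ⟨
    toℚᵘ (+ q / suc e) ℚᵘ.* toℚᵘ (+ r / suc f) ≈⟨ toℚᵘ-homo-* (+ q / suc e) (+ r / suc f) ⟨
    toℚᵘ ((+ q / suc e) * (+ r / suc f))       ∎)
  where
  open ℚᵘ.≃-Reasoning
  cross-ℤ : + p ℤ.* + (suc e ℕ.* suc f) ≡ (+ q ℤ.* + r) ℤ.* + suc d
  cross-ℤ = trans (sym (pos-* p _))
              (trans (cong +_ cross) (trans (pos-* (q ℕ.* r) (suc d)) (cong (ℤ._* + suc d) (pos-* q r))))

lemma5p4 : ∀ {q s} (a b : Vec ℕ q) (c : Vec ℕ s) (n : ℕ) → 2 ≤ n →
    Γ n (a ++ c) (b ++ replicate s 0)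
      ≡ dfRatio (n ∸ 2) (sum b + sum c + n ∸ 2) (sum b + n ∸ 2) (sum c + n ∸ 2)
          * Γ (n + sum c) a b
lemma5p4 {q} {s} a b c n _ =
  cross⇒/≡/*/ (ΓNum n X Y) (ΓDen n X Y)
              (dfact (n ∸ 2) ℕ.* dfact (sum b + sum c + n ∸ 2)) (dfact (sum b + n ∸ 2) ℕ.* dfact (sum c + n ∸ 2))
              (ΓNum (n + sum c) a b) (ΓDen (n + sum c) a b)
              {{ΓDen-nz n X Y}}
              {{m*n≢0 _ _ {{dfact-nz (sum b + n ∸ 2)}} {{dfact-nz (sum c + n ∸ 2)}}}}
              {{ΓDen-nz (n + sum c) a b}}
              (Γ-cross a b c n)
  where
  X Y : Vec ℕ (q + s)
  X = a ++ c
  Y = b ++ replicate s 0
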